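{- Let $n\in\mathbb{N}$. Every subset $P\subset[n]$ with $|P|\le\frac{n-1}{2}$ belongs to $\mathsf{APS}^B_n$.
   Context: $[n]=\{1,\dots,n\}$, $\pm[n]=[n]\cup-[n]$. $\mathfrak{S}_n^B$ is the group of bijections $w:\pm[n]\to\pm[n]$ with $w(-i)=-w(i)$, written in one-line notation $w(1)\cdots w(n)$. A pinnacle of $w$ is a value $w(i)$ with $2\le i\le n-1$ and $w(i-1)<w(i)>w(i+1)$; the pinnacle set of $w$ is the set of its pinnacles. $\mathsf{APS}^B_n$ is the set of pinnacle sets of elements of $\mathfrak{S}_n^B$. -}

module Defs where

open import Data.Nat using (ℕ; suc)
open import Data.Integer using (ℤ; +_; -_; _<_)
open import Data.Bool using (Bool; true; false)
open import Data.Fin using (Fin; toℕ)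
open import Data.Fin.Subset using (Subset; _∈_)
open import Data.Fin.Permutation using (Permutation′; _⟨$⟩ʳ_)
open import Data.Product using (Σ; _×_; ∃)
open import Function.Bundles using (_⇔_)
open import Relation.Binary.PropositionalEquality using (_≡_)

-- An element of the hyperoctahedral group 𝔖ᴮₙ: a signed permutation of ±[n],
-- encoded by the underlying permutation |w| of [n] and the signs of w(1..n).
-- Position i (1-based) is the Fin index i-1; value k ∈ [n] is Fin index k-1.
record SignedPerm (n : ℕ) : Set where
  field
    perm : Permutation′ n
    negative : Fin n → Bool

open SignedPerm public

oneLine : ∀ {n} → SignedPerm n → Fin n → ℤ
oneLine w i with negative w i
... | true  = - (+ suc (toℕ (perm w ⟨$⟩ʳ i)))
... | false = + suc (toℕ (perm w ⟨$⟩ʳ i))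

IsPinnacle : ∀ {n} → SignedPerm n → ℤ → Set
IsPinnacle {n} w x =
  Σ (Fin n) λ i → Σ (Fin n) λ j → Σ (Fin n) λ k →
    (toℕ j ≡ suc (toℕ i)) × (toℕ k ≡ suc (toℕ j)) ×
    (oneLine w i < oneLine w j) × (oneLine w k < oneLine w j) ×
    (oneLine w j ≡ x)

InAPSB : (n : ℕ) → (ℤ → Set) → Set
InAPSB n S = Σ (SignedPerm n) λ w → ∀ x → IsPinnacle w x ⇔ S x

subsetToℤ : ∀ {n} → Subset n → ℤ → Set
subsetToℤ {n} P x = Σ (Fin n) λ k → (k ∈ P) × (x ≡ + suc (toℕ k))

{-# OPTIONS --safe #-}
-- Let k = |P| and let q₁ < q₂ < ⋯ < q_m enumerate [n] ∖ P, so m > k. The signed permutation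
--   −q₁ p₁ −q₂ p₂ ⋯ −q_k p_k −q_{k+1} ⋯ −q_m
-- has pinnacle set P: each pᵢ sits between two negative entries, and no negative entry is a
-- pinnacle, because its left neighbour is positive or is the larger negative −q_{i-1}.
-- Its absolute values are obtained by shuffling P into the sign pattern order-preservingly.
module Submission where

open import Defs
open import Data.Nat using (ℕ; zero; suc; pred; _≤_; _*_; _+_; z≤n; s≤s)
  renaming (_<_ to _<ℕ_)
open import Data.Nat.Properties using (≤-reflexive; *-suc; +-comm; +-cancelˡ-≤; +-cancelˡ-<; <⇒≤)
open import Data.Bool.Base using (not)
open import Data.Bool.Properties using () renaming (_≟_ to _≟ˢ_)
open import Data.Fin.Base as Fin using (Fin; zero; suc; toℕ; punchIn)
open import Data.Fin.Properties
  using (punchOut-punchIn; punchInᵢ≢i; punchIn-punchOut; <-irrefl; <-asym)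
  renaming (_≟_ to _≟ᶠ_)
open import Data.Fin.Permutation
  using (Permutation′; _⟨$⟩ʳ_; _⟨$⟩ˡ_; id; insert; insert-punchIn; inverseʳ)
open import Data.Fin.Subset using (Subset; Side; inside; outside; ∣_∣) renaming (⊥ to ∅)
open import Data.Fin.Subset.Properties using (∣p∣≤n; ∣⊥∣≡0)
open import Data.Integer.Base using (ℤ; +_; -[1+_]; _<_; -<+; -<-)
open import Data.Product using (∃; _×_; _,_; proj₁; proj₂)
open import Data.Vec.Base using (Vec; []; _∷_; lookup; removeAt)
open import Data.Vec.Properties using (removeAt-punchOut; lookup-replicate; lookup⇒[]=; []=⇒lookup)
open import Function.Base using (_∘_)
open import Function.Bundles using (mk⇔)
open import Relation.Binary.PropositionalEquality
open import Relation.Nullary using (yes; no; contradiction)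

∣x∷y∷p∣≡∣y∷x∷p∣ : ∀ {n} x y (p : Subset n) → ∣ x ∷ y ∷ p ∣ ≡ ∣ y ∷ x ∷ p ∣
∣x∷y∷p∣≡∣y∷x∷p∣ inside  inside  p = refl
∣x∷y∷p∣≡∣y∷x∷p∣ inside  outside p = refl
∣x∷y∷p∣≡∣y∷x∷p∣ outside inside  p = refl
∣x∷y∷p∣≡∣y∷x∷p∣ outside outside p = refl

∣p∣≡∣q∣⇒∣x∷p∣≡∣x∷q∣ : ∀ {n} x (p q : Subset n) → ∣ p ∣ ≡ ∣ q ∣ → ∣ x ∷ p ∣ ≡ ∣ x ∷ q ∣
∣p∣≡∣q∣⇒∣x∷p∣≡∣x∷q∣ inside  p q = cong suc
∣p∣≡∣q∣⇒∣x∷p∣≡∣x∷q∣ outside p q = λ e → e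

∣x∷p∣≡∣x∷q∣⇒∣p∣≡∣q∣ : ∀ {n} x (p q : Subset n) → ∣ x ∷ p ∣ ≡ ∣ x ∷ q ∣ → ∣ p ∣ ≡ ∣ q ∣
∣x∷p∣≡∣x∷q∣⇒∣p∣≡∣q∣ inside  p q = cong pred
∣x∷p∣≡∣x∷q∣⇒∣p∣≡∣q∣ outside p q = λ e → e

∣lookup∷removeAt∣≡∣p∣ : ∀ {n} (p : Subset (suc n)) i → ∣ lookup p i ∷ removeAt p i ∣ ≡ ∣ p ∣
∣lookup∷removeAt∣≡∣p∣ (x ∷ p)     zero    = refl
∣lookup∷removeAt∣≡∣p∣ (x ∷ y ∷ p) (suc i) =
  trans (∣x∷y∷p∣≡∣y∷x∷p∣ (lookup (y ∷ p) i) x (removeAt (y ∷ p) i))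
        (∣p∣≡∣q∣⇒∣x∷p∣≡∣x∷q∣ x (lookup (y ∷ p) i ∷ removeAt (y ∷ p) i) (y ∷ p)
          (∣lookup∷removeAt∣≡∣p∣ (y ∷ p) i))

∣removeAt∣ : ∀ {n} (p : Subset (suc n)) {i b} (q : Subset n) →
             lookup p i ≡ b → ∣ p ∣ ≡ ∣ b ∷ q ∣ → ∣ removeAt p i ∣ ≡ ∣ q ∣
∣removeAt∣ p {i} q refl e =
  ∣x∷p∣≡∣x∷q∣⇒∣p∣≡∣q∣ (lookup p i) (removeAt p i) q (trans (∣lookup∷removeAt∣≡∣p∣ p i) e)

lookup-removeAt : ∀ {A : Set} {n} (xs : Vec A (suc n)) i j →
                  lookup (removeAt xs i) j ≡ lookup xs (punchIn i j)
lookup-removeAt xs i j =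
  trans (cong (lookup (removeAt xs i)) (sym (punchOut-punchIn i)))
        (removeAt-punchOut xs (punchInᵢ≢i i j ∘ sym))

0<∣p∣⇒inside∈p : ∀ {n} (p : Subset n) → 0 <ℕ ∣ p ∣ → ∃ λ i → lookup p i ≡ inside
0<∣p∣⇒inside∈p (inside  ∷ p) _ = zero , refl
0<∣p∣⇒inside∈p (outside ∷ p) h = let i , e = 0<∣p∣⇒inside∈p p h in suc i , e

∣p∣<n⇒outside∈p : ∀ {n} (p : Subset n) → ∣ p ∣ <ℕ n → ∃ λ i → lookup p i ≡ outside
∣p∣<n⇒outside∈p (outside ∷ p) _       = zero , refl
∣p∣<n⇒outside∈p (inside  ∷ p) (s≤s h) = let i , e = ∣p∣<n⇒outside∈p p h in suc i , e

∣p∣≡∣b∷q∣⇒b∈p : ∀ {n} (p : Subset (suc n)) b (q : Subset n) →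
                ∣ p ∣ ≡ ∣ b ∷ q ∣ → ∃ λ i → lookup p i ≡ b
∣p∣≡∣b∷q∣⇒b∈p p inside  q e = 0<∣p∣⇒inside∈p p (subst (0 <ℕ_) (sym e) (s≤s z≤n))
∣p∣≡∣b∷q∣⇒b∈p p outside q e = ∣p∣<n⇒outside∈p p (subst (_<ℕ _) (sym e) (s≤s (∣p∣≤n q)))

IsFirstOccurrence : ∀ {n} → Side → Subset n → Fin n → Set
IsFirstOccurrence b p i = lookup p i ≡ b × (∀ j → j Fin.< i → lookup p j ≢ b)

firstOccurrence : ∀ {n} b (p : Subset n) i → lookup p i ≡ b → ∃ (IsFirstOccurrence b p)
firstOccurrence b (x ∷ p) zero    e = zero , e , λ _ ()
firstOccurrence b (x ∷ p) (suc i) e with x ≟ˢ b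
... | yes x≡b = zero , x≡b , λ _ ()
... | no  x≢b =
  let i′ , e′ , minimal = firstOccurrence b p i e
  in suc i′ , e′ , λ { zero _ → x≢b ; (suc j) (s≤s j<i′) → minimal j j<i′ }

data PunchInView {n} (i : Fin (suc n)) : Fin (suc n) → Set where
  at      : PunchInView i i
  punched : ∀ j → PunchInView i (punchIn i j)

punchInView : ∀ {n} (i j : Fin (suc n)) → PunchInView i j
punchInView i j with i ≟ᶠ j
... | yes refl = at
... | no  i≢j  = subst (PunchInView i) (punchIn-punchOut i≢j) (punched _)

punchIn-cancel-< : ∀ {n} (i : Fin (suc n)) j k → punchIn i j Fin.< punchIn i k → j Fin.< k
punchIn-cancel-< zero    j       k       (s≤s j<k) = j<k
punchIn-cancel-< (suc i) zero    (suc k) _         = s≤s z≤n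
punchIn-cancel-< (suc i) (suc j) (suc k) (s≤s j<k) = s≤s (punchIn-cancel-< i j k j<k)

insert-at : ∀ {m n} (i : Fin (suc m)) (j : Fin (suc n)) π → insert i j π ⟨$⟩ʳ i ≡ j
insert-at i j π with i ≟ᶠ i
... | yes _   = refl
... | no  i≢i = contradiction refl i≢i

pivot : ∀ {n} (p : Subset (suc n)) b (q : Subset n) → ∣ p ∣ ≡ ∣ b ∷ q ∣ → ∃ (IsFirstOccurrence b p)
pivot p b q e = let i , pᵢ≡b = ∣p∣≡∣b∷q∣⇒b∈p p b q e in firstOccurrence b p i pᵢ≡b

ClasswiseIncreasing : ∀ {n} → (Fin n → Side) → Permutation′ n → Set
ClasswiseIncreasing f σ = ∀ {i j} → i Fin.< j → f i ≡ f j → σ ⟨$⟩ʳ i Fin.< σ ⟨$⟩ʳ j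

module _ {n} (p : Subset (suc n)) (i : Fin (suc n)) (π : Permutation′ n) where

  lookup-insert-zero : ∀ {b} {q : Subset n} → lookup p i ≡ b →
    (∀ j → lookup q (π ⟨$⟩ʳ j) ≡ lookup (removeAt p i) j) →
    ∀ j → lookup (b ∷ q) (insert i zero π ⟨$⟩ʳ j) ≡ lookup p j
  lookup-insert-zero {b} {q} pᵢ≡b lookup-π j with punchInView i j
  ... | at = begin
    lookup (b ∷ q) (insert i zero π ⟨$⟩ʳ i) ≡⟨ cong (lookup (b ∷ q)) (insert-at i zero π) ⟩
    b                                       ≡⟨ sym pᵢ≡b ⟩
    lookup p i                              ∎
    where open ≡-Reasoning
  ... | punched j′ = begin
    lookup (b ∷ q) (insert i zero π ⟨$⟩ʳ punchIn i j′)
      ≡⟨ cong (lookup (b ∷ q)) (insert-punchIn i zero π j′) ⟩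
    lookup q (π ⟨$⟩ʳ j′)
      ≡⟨ lookup-π j′ ⟩
    lookup (removeAt p i) j′
      ≡⟨ lookup-removeAt p i j′ ⟩
    lookup p (punchIn i j′)
      ∎
    where open ≡-Reasoning

  insert-zero-classwiseIncreasing : ∀ {b} → IsFirstOccurrence b p i →
    ClasswiseIncreasing (lookup (removeAt p i)) π → ClasswiseIncreasing (lookup p) (insert i zero π)
  insert-zero-classwiseIncreasing {b} (pᵢ≡b , minimal) π-incr {j} {k} j<k pⱼ≡pₖ
    with punchInView i j | punchInView i k
  ... | at         | at         = contradiction j<k (<-irrefl refl)
  ... | at         | punched k′
    rewrite insert-at i zero π | insert-punchIn i zero π k′ = s≤s z≤n
  ... | punched j′ | at         = contradiction (trans pⱼ≡pₖ pᵢ≡b) (minimal (punchIn i j′) j<k)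
  ... | punched j′ | punched k′
    rewrite insert-punchIn i zero π j′ | insert-punchIn i zero π k′ =
    s≤s (π-incr (punchIn-cancel-< i j′ k′ j<k)
                (trans (lookup-removeAt p i j′) (trans pⱼ≡pₖ (sym (lookup-removeAt p i k′)))))

-- shuffle p q sends the positions of each class of p, in increasing order, to the
-- elements of the same class of q, in increasing order.
shuffle : ∀ {n} (p q : Subset n) → ∣ p ∣ ≡ ∣ q ∣ → Permutation′ n

module ShuffleStep {n} (p : Subset (suc n)) (b : Side) (q : Subset n) (e : ∣ p ∣ ≡ ∣ b ∷ q ∣) where
  i : Fin (suc n)
  i = proj₁ (pivot p b q e)

  i-first : IsFirstOccurrence b p i
  i-first = proj₂ (pivot p b q e)

  ∣p′∣≡∣q∣ : ∣ removeAt p i ∣ ≡ ∣ q ∣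
  ∣p′∣≡∣q∣ = ∣removeAt∣ p q (proj₁ i-first) e

  σ′ : Permutation′ n
  σ′ = shuffle (removeAt p i) q ∣p′∣≡∣q∣

shuffle _ []      _ = id
shuffle p (b ∷ q) e = insert i zero σ′
  where open ShuffleStep p b q e

lookup-shuffle : ∀ {n} (p q : Subset n) e i → lookup q (shuffle p q e ⟨$⟩ʳ i) ≡ lookup p i
lookup-shuffle _ []      _ ()
lookup-shuffle p (b ∷ q) e =
  lookup-insert-zero p i σ′ (proj₁ i-first) (lookup-shuffle (removeAt p i) q ∣p′∣≡∣q∣)
  where open ShuffleStep p b q e

shuffle-classwiseIncreasing : ∀ {n} (p q : Subset n) e →
                              ClasswiseIncreasing (lookup p) (shuffle p q e)
shuffle-classwiseIncreasing _ []      _ {()}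
shuffle-classwiseIncreasing p (b ∷ q) e =
  insert-zero-classwiseIncreasing p i σ′ i-first
    (shuffle-classwiseIncreasing (removeAt p i) q ∣p′∣≡∣q∣)
  where open ShuffleStep p b q e

-- outside inside outside inside ⋯ (k times) followed by outsides; junk unless 2k ≤ n.
peakPattern : ℕ → (n : ℕ) → Subset n
peakPattern (suc k) (suc (suc n)) = outside ∷ inside ∷ peakPattern k n
peakPattern _       _             = ∅

2*suc≤2+⇒2*≤ : ∀ k n → 2 * suc k ≤ 2 + n → 2 * k ≤ n
2*suc≤2+⇒2*≤ k n h = +-cancelˡ-≤ 2 (2 * k) n (subst (_≤ 2 + n) (*-suc 2 k) h)

2*suc<2+⇒2*< : ∀ k n → 2 * suc k <ℕ 2 + n → 2 * k <ℕ n
2*suc<2+⇒2*< k n h = +-cancelˡ-< 2 (2 * k) n (subst (_<ℕ 2 + n) (*-suc 2 k) h)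

∣peakPattern∣ : ∀ k n → 2 * k ≤ n → ∣ peakPattern k n ∣ ≡ k
∣peakPattern∣ zero    n             _ = ∣⊥∣≡0 n
∣peakPattern∣ (suc k) (suc (suc n)) h = cong suc (∣peakPattern∣ k n (2*suc≤2+⇒2*≤ k n h))
∣peakPattern∣ (suc k) (suc zero)    h = contradiction (subst (_≤ 1) (*-suc 2 k) h) λ { (s≤s ()) }

lookup-peakPattern-zero : ∀ k n → lookup (peakPattern k (suc n)) zero ≡ outside
lookup-peakPattern-zero zero    n       = refl
lookup-peakPattern-zero (suc k) zero    = refl
lookup-peakPattern-zero (suc k) (suc n) = refl

record Flanked {n} (f : Fin n → Side) (j : Fin n) : Set where
  field
    left           : Fin n
    right          : Fin n
    left-adjacent  : toℕ j ≡ suc (toℕ left)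
    right-adjacent : toℕ right ≡ suc (toℕ j)
    left-outside   : f left ≡ outside
    right-outside  : f right ≡ outside

Flanked-cong : ∀ {n} {f g : Fin n → Side} {j} → (∀ i → f i ≡ g i) → Flanked f j → Flanked g j
Flanked-cong f≗g fl = record
  { left           = left
  ; right          = right
  ; left-adjacent  = left-adjacent
  ; right-adjacent = right-adjacent
  ; left-outside   = trans (sym (f≗g left)) left-outside
  ; right-outside  = trans (sym (f≗g right)) right-outside
  }
  where open Flanked fl

Flanked-∷∷ : ∀ {n} {p : Subset n} {j} x y →
             Flanked (lookup p) j → Flanked (lookup (x ∷ y ∷ p)) (suc (suc j))
Flanked-∷∷ x y fl = record
  { left           = suc (suc left)
  ; right          = suc (suc right)
  ; left-adjacent  = cong (λ m → 2 + m) left-adjacent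
  ; right-adjacent = cong (λ m → 2 + m) right-adjacent
  ; left-outside   = left-outside
  ; right-outside  = right-outside
  }
  where open Flanked fl

peakPattern-flanked : ∀ k n → 2 * k <ℕ n → ∀ j →
  lookup (peakPattern k n) j ≡ inside → Flanked (lookup (peakPattern k n)) j
peakPattern-flanked zero    n                   h j             pⱼ≡inside =
  contradiction (trans (sym (lookup-replicate j outside)) pⱼ≡inside) λ ()
peakPattern-flanked k       (suc n)             h zero          p₀≡inside =
  contradiction (trans (sym (lookup-peakPattern-zero k n)) p₀≡inside) λ ()
peakPattern-flanked (suc k) (suc (suc n))       h (suc (suc j)) pⱼ≡inside =
  Flanked-∷∷ outside inside (peakPattern-flanked k n (2*suc<2+⇒2*< k n h) j pⱼ≡inside)
peakPattern-flanked (suc k) (suc (suc (suc n))) h (suc zero)    _ = record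
  { left           = zero
  ; right          = suc (suc zero)
  ; left-adjacent  = refl
  ; right-adjacent = refl
  ; left-outside   = refl
  ; right-outside  = lookup-peakPattern-zero k n
  }
peakPattern-flanked (suc k) (suc (suc zero))    h (suc zero)    _ =
  contradiction (2*suc<2+⇒2*< k 0 h) λ ()

signBy : ∀ {n} → Subset n → Permutation′ n → SignedPerm n
signBy P σ = record { perm = σ ; negative = λ i → not (lookup P (σ ⟨$⟩ʳ i)) }

signed : ∀ {n} → Side → Fin n → ℤ
signed inside  v = + suc (toℕ v)
signed outside v = -[1+ toℕ v ]

module _ {n} {P : Subset n} {σ : Permutation′ n} where

  oneLine-signBy : ∀ i → oneLine (signBy P σ) i ≡ signed (lookup P (σ ⟨$⟩ʳ i)) (σ ⟨$⟩ʳ i)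
  oneLine-signBy i with lookup P (σ ⟨$⟩ʳ i)
  ... | inside  = refl
  ... | outside = refl

  oneLine-signBy-side : ∀ {s} i → lookup P (σ ⟨$⟩ʳ i) ≡ s →
                        oneLine (signBy P σ) i ≡ signed s (σ ⟨$⟩ʳ i)
  oneLine-signBy-side i refl = oneLine-signBy i

  signed<outside⇒ : ∀ s (a b : Fin n) → signed s a < signed outside b → s ≡ outside × b Fin.< a
  signed<outside⇒ outside a b (-<- b<a) = refl , b<a

  pinnacle⇒∈ : ClasswiseIncreasing (λ i → lookup P (σ ⟨$⟩ʳ i)) σ →
               ∀ x → IsPinnacle (signBy P σ) x → subsetToℤ P x
  pinnacle⇒∈ incr x (i , j , _ , j≡1+i , _ , wᵢ<wⱼ , _ , wⱼ≡x) =
    pinnacleAt (lookup P (σ ⟨$⟩ʳ j)) refl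
      (subst₂ _<_ (oneLine-signBy i) (oneLine-signBy j) wᵢ<wⱼ) (trans (sym (oneLine-signBy j)) wⱼ≡x)
    where
    pinnacleAt : ∀ s → lookup P (σ ⟨$⟩ʳ j) ≡ s →
      signed (lookup P (σ ⟨$⟩ʳ i)) (σ ⟨$⟩ʳ i) < signed s (σ ⟨$⟩ʳ j) →
      signed s (σ ⟨$⟩ʳ j) ≡ x → subsetToℤ P x
    pinnacleAt inside  Pσⱼ≡inside  _     wⱼ≡x =
      σ ⟨$⟩ʳ j , lookup⇒[]= (σ ⟨$⟩ʳ j) P Pσⱼ≡inside , sym wⱼ≡x
    pinnacleAt outside Pσⱼ≡outside wᵢ<wⱼ _    =
      let Pσᵢ≡outside , σⱼ<σᵢ = signed<outside⇒ _ _ _ wᵢ<wⱼ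
      in contradiction (incr (≤-reflexive (sym j≡1+i)) (trans Pσᵢ≡outside (sym Pσⱼ≡outside)))
                       (<-asym σⱼ<σᵢ)

  flanked⇒pinnacle : ∀ j → Flanked (λ i → lookup P (σ ⟨$⟩ʳ i)) j → lookup P (σ ⟨$⟩ʳ j) ≡ inside →
    IsPinnacle (signBy P σ) (+ suc (toℕ (σ ⟨$⟩ʳ j)))
  flanked⇒pinnacle j fl Pσⱼ≡inside =
    left , j , right , left-adjacent , right-adjacent ,
    below left left-outside , below right right-outside , oneLine-signBy-side j Pσⱼ≡inside
    where
    open Flanked fl
    below : ∀ i → lookup P (σ ⟨$⟩ʳ i) ≡ outside → oneLine (signBy P σ) i < oneLine (signBy P σ) j
    below i Pσᵢ≡outside =
      subst₂ _<_ (sym (oneLine-signBy-side i Pσᵢ≡outside))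
                 (sym (oneLine-signBy-side j Pσⱼ≡inside)) -<+

  ∈⇒pinnacle : (∀ j → lookup P (σ ⟨$⟩ʳ j) ≡ inside → Flanked (λ i → lookup P (σ ⟨$⟩ʳ i)) j) →
    ∀ x → subsetToℤ P x → IsPinnacle (signBy P σ) x
  ∈⇒pinnacle flanked x (v , v∈P , x≡1+v) =
    subst (IsPinnacle (signBy P σ)) (trans (cong (λ u → + suc (toℕ u)) σⱼ≡v) (sym x≡1+v))
      (flanked⇒pinnacle j (flanked j Pσⱼ≡inside) Pσⱼ≡inside)
    where
    j = σ ⟨$⟩ˡ v
    σⱼ≡v : σ ⟨$⟩ʳ j ≡ v
    σⱼ≡v = inverseʳ σ
    Pσⱼ≡inside : lookup P (σ ⟨$⟩ʳ j) ≡ inside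
    Pσⱼ≡inside = trans (cong (lookup P) σⱼ≡v) ([]=⇒lookup v∈P)

corollary3p2 : (n : ℕ) (P : Subset n) → 2 * ∣ P ∣ + 1 ≤ n →
    InAPSB n (subsetToℤ P)
corollary3p2 n P h = signBy P σ , λ x → mk⇔ (pinnacle⇒∈ increasing x) (∈⇒pinnacle flanked x)
  where
  2∣P∣<n : 2 * ∣ P ∣ <ℕ n
  2∣P∣<n = subst (_≤ n) (+-comm (2 * ∣ P ∣) 1) h

  peaks : Subset n
  peaks = peakPattern ∣ P ∣ n

  ∣peaks∣≡∣P∣ : ∣ peaks ∣ ≡ ∣ P ∣
  ∣peaks∣≡∣P∣ = ∣peakPattern∣ ∣ P ∣ n (<⇒≤ 2∣P∣<n)

  σ : Permutation′ n
  σ = shuffle peaks P ∣peaks∣≡∣P∣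

  Pσ≗peaks : ∀ i → lookup P (σ ⟨$⟩ʳ i) ≡ lookup peaks i
  Pσ≗peaks = lookup-shuffle peaks P ∣peaks∣≡∣P∣

  increasing : ClasswiseIncreasing (λ i → lookup P (σ ⟨$⟩ʳ i)) σ
  increasing {i} {j} i<j Pσᵢ≡Pσⱼ = shuffle-classwiseIncreasing peaks P ∣peaks∣≡∣P∣ i<j
    (trans (sym (Pσ≗peaks i)) (trans Pσᵢ≡Pσⱼ (Pσ≗peaks j)))

  flanked : ∀ j → lookup P (σ ⟨$⟩ʳ j) ≡ inside → Flanked (λ i → lookup P (σ ⟨$⟩ʳ i)) j
  flanked j Pσⱼ≡inside = Flanked-cong (sym ∘ Pσ≗peaks)
    (peakPattern-flanked ∣ P ∣ n 2∣P∣<n j (trans (sym (Pσ≗peaks j)) Pσⱼ≡inside))
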